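{- Let $P$ and $Q$ be finite posets with height functions $g$ and $h$ respectively. Endow $P\times Q$ (product order) with the height function $g+h:(a,b)\mapsto g(a)+h(b)$, and $P\sqcup Q$ (disjoint union) with the height function $g\sqcup h$ equal to $g$ on $P$ and $h$ on $Q$. Then $\mathsf{Z}_{P\times Q,g+h}=\mathsf{Z}_{P,g}\,\mathsf{Z}_{Q,h}$ and $\mathsf{Z}_{P\sqcup Q,g\sqcup h}=\mathsf{Z}_{P,g}+\mathsf{Z}_{Q,h}$.
   Context: Let $q$ be an indeterminate and $[n]_q=(q^n-1)/(q-1)$. A height function on a finite poset $R$ is a map $f:R\to\mathbb{N}$ with $f(x)<f(y)$ whenever $y$ covers $x$. The $q$-Zeta polynomial $\mathsf{Z}_{R,f}(x)\in\mathbb{Q}(q)[x]$ is the unique polynomial such that for every integer $n\ge2$, $\mathsf{Z}_{R,f}([n]_q)=\sum_{e_1\le\cdots\le e_{n-1}}q^{f(e_1)+\cdots+f(e_{n-1})}$, summed over all weakly increasing sequences of $n-1$ elements of $R$. -}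

module Defs where

open import Data.Nat using (ℕ; zero; suc; _<_) renaming (_+_ to _+ℕ_)
open import Data.Integer using (ℤ; +_) renaming (_+_ to _+ℤ_; _*_ to _*ℤ_)
open import Data.List using (List; []; _∷_; _++_; map; replicate; concatMap; foldr)
open import Data.Nat.ListAction using (sum)
open import Data.List.Membership.Propositional using (_∈_)
open import Data.List.Relation.Unary.Unique.Propositional using (Unique)
open import Data.Product using (_×_; _,_; proj₁; proj₂; Σ)
open import Data.Sum using (_⊎_; inj₁; inj₂)
open import Data.Bool using (Bool; true; false; if_then_else_; _∧_)
open import Data.Empty using (⊥)
open import Relation.Nullary using (¬_; Dec; yes; no)
open import Relation.Nullary.Decidable using (⌊_⌋)
open import Relation.Binary.Definitions using (Decidable)
open import Relation.Binary.Structures using (IsPartialOrder)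
open import Relation.Binary.PropositionalEquality using (_≡_; _≢_)

-- ℤ[q] : polynomials in the indeterminate q, as coefficient lists
-- (constant term first).  Equality is coefficientwise.

Poly : Set
Poly = List ℤ

coeff : Poly → ℕ → ℤ
coeff []      _       = + 0
coeff (a ∷ p) zero    = a
coeff (a ∷ p) (suc i) = coeff p i

_≈P_ : Poly → Poly → Set
p ≈P r = ∀ i → coeff p i ≡ coeff r i

infixl 6 _+P_
infixl 7 _*P_

_+P_ : Poly → Poly → Poly
[]      +P r       = r
(a ∷ p) +P []      = a ∷ p
(a ∷ p) +P (b ∷ r) = (a +ℤ b) ∷ (p +P r)

_*P_ : Poly → Poly → Poly
[]      *P r = []
(a ∷ p) *P r = map (a *ℤ_) r +P (+ 0 ∷ (p *P r))

mono : ℕ → Poly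
mono k = replicate k (+ 0) ++ (+ 1 ∷ [])

qint : ℕ → Poly
qint n = replicate n (+ 1)

PolyX : Set
PolyX = List Poly

coeffX : PolyX → ℕ → Poly
coeffX []      _       = []
coeffX (c ∷ p) zero    = c
coeffX (c ∷ p) (suc i) = coeffX p i

_≈X_ : PolyX → PolyX → Set
N ≈X M = ∀ i → coeffX N i ≈P coeffX M i

infixl 6 _+X_
infixl 7 _*X_

_+X_ : PolyX → PolyX → PolyX
[]      +X M       = M
(a ∷ N) +X []      = a ∷ N
(a ∷ N) +X (b ∷ M) = (a +P b) ∷ (N +X M)

_*X_ : PolyX → PolyX → PolyX
[]      *X M = []
(a ∷ N) *X M = map (a *P_) M +X ([] ∷ (N *X M))

_·X_ : Poly → PolyX → PolyX
d ·X N = map (d *P_) N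

evalX : PolyX → Poly → Poly
evalX []      t = []
evalX (c ∷ N) t = c +P (t *P evalX N t)

-- ℚ(q)[x] = Frac(ℤ[q])[x].  Every element is written N(q,x)/D(q) with
-- N ∈ ℤ[q][x] and D ∈ ℤ[q] nonzero (common denominator).

record QX : Set where
  constructor _/ₓ_
  field
    num : PolyX
    den : Poly

open QX public

Valid : QX → Set
Valid Z = ¬ (den Z ≈P [])

_≈Z_ : QX → QX → Set
Z ≈Z W = (den W ·X num Z) ≈X (den Z ·X num W)

_·Z_ : QX → QX → QX
Z ·Z W = (num Z *X num W) /ₓ (den Z *P den W)

_+Z_ : QX → QX → QX
Z +Z W = ((den W ·X num Z) +X (den Z ·X num W)) /ₓ (den Z *P den W)

record FinOrd : Set₁ where
  field
    Carrier : Set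
    _≤_     : Carrier → Carrier → Set
    _≤?_    : Decidable _≤_
    elems   : List Carrier

open FinOrd public

record IsFinPoset (R : FinOrd) : Set where
  field
    isPartialOrder : IsPartialOrder _≡_ (_≤_ R)
    complete       : ∀ x → x ∈ elems R
    unique         : Unique (elems R)

Covers : (R : FinOrd) → Carrier R → Carrier R → Set
Covers R x y = (_≤_ R x y × x ≢ y)
             × (∀ z → _≤_ R x z → _≤_ R z y → (z ≡ x) ⊎ (z ≡ y))

IsHeight : (R : FinOrd) → (Carrier R → ℕ) → Set
IsHeight R f = ∀ x y → Covers R x y → f x < f y

_×ₚ_ : FinOrd → FinOrd → FinOrd
P ×ₚ Q = record
  { Carrier = Carrier P × Carrier Q
  ; _≤_     = λ u v → _≤_ P (proj₁ u) (proj₁ v) × _≤_ Q (proj₂ u) (proj₂ v)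
  ; _≤?_    = dec
  ; elems   = concatMap (λ a → map (a ,_) (elems Q)) (elems P)
  }
  where
  dec : _
  dec (a , b) (a' , b') with _≤?_ P a a' | _≤?_ Q b b'
  ... | yes p | yes r = yes (p , r)
  ... | no ¬p | _     = no (λ pr → ¬p (proj₁ pr))
  ... | yes _ | no ¬r = no (λ pr → ¬r (proj₂ pr))

data _⊎≤_ (P Q : FinOrd) : Carrier P ⊎ Carrier Q → Carrier P ⊎ Carrier Q → Set where
  ≤₁ : ∀ {a a'} → _≤_ P a a' → _⊎≤_ P Q (inj₁ a) (inj₁ a')
  ≤₂ : ∀ {b b'} → _≤_ Q b b' → _⊎≤_ P Q (inj₂ b) (inj₂ b')

_⊎ₚ_ : FinOrd → FinOrd → FinOrd
P ⊎ₚ Q = record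
  { Carrier = Carrier P ⊎ Carrier Q
  ; _≤_     = _⊎≤_ P Q
  ; _≤?_    = dec
  ; elems   = map inj₁ (elems P) ++ map inj₂ (elems Q)
  }
  where
  dec : Decidable (_⊎≤_ P Q)
  dec (inj₁ a) (inj₁ a') with _≤?_ P a a'
  ... | yes p = yes (≤₁ p)
  ... | no ¬p = no (λ { (≤₁ p) → ¬p p })
  dec (inj₁ a) (inj₂ b) = no (λ ())
  dec (inj₂ b) (inj₁ a) = no (λ ())
  dec (inj₂ b) (inj₂ b') with _≤?_ Q b b'
  ... | yes p = yes (≤₂ p)
  ... | no ¬p = no (λ { (≤₂ p) → ¬p p })

heightSum : (P Q : FinOrd) → (Carrier P → ℕ) → (Carrier Q → ℕ) → Carrier (P ×ₚ Q) → ℕ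
heightSum P Q g h (a , b) = g a +ℕ h b

heightUnion : (P Q : FinOrd) → (Carrier P → ℕ) → (Carrier Q → ℕ) → Carrier (P ⊎ₚ Q) → ℕ
heightUnion P Q g h (inj₁ a) = g a
heightUnion P Q g h (inj₂ b) = h b

seqs : (R : FinOrd) → ℕ → List (List (Carrier R))
seqs R zero    = [] ∷ []
seqs R (suc m) = concatMap (λ x → map (x ∷_) (seqs R m)) (elems R)

weaklyIncreasing : (R : FinOrd) → List (Carrier R) → Bool
weaklyIncreasing R []           = true
weaklyIncreasing R (x ∷ [])     = true
weaklyIncreasing R (x ∷ y ∷ xs) = ⌊ _≤?_ R x y ⌋ ∧ weaklyIncreasing R (y ∷ xs)

multichainPoly : (R : FinOrd) → (Carrier R → ℕ) → ℕ → Poly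
multichainPoly R f m =
  foldr _+P_ []
    (map (λ s → if weaklyIncreasing R s then mono (sum (map f s)) else [])
         (seqs R m))

-- Z is (a representative of) the q-Zeta polynomial Z_{R,f}:
-- Z([n]_q) = Σ_{e₁ ≤ ⋯ ≤ e_{n-1}} q^{Σ f(eᵢ)} in ℚ(q), for every n ≥ 2
-- (n = m + 2, sequences of length n - 1 = m + 1).
IsQZeta : (R : FinOrd) → (Carrier R → ℕ) → QX → Set
IsQZeta R f Z =
  Valid Z × (∀ m → evalX (num Z) (qint (suc (suc m)))
                     ≈P (den Z *P multichainPoly R f (suc m)))

-- Both identities are identities of polynomials in q and x, so it suffices
-- to check them after substituting positive integers for q and the values
-- [n]_q (n ≥ 2) for x: infinitely many values of x determine a polynomial
-- in x, and infinitely many values of q determine its coefficients.  After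
-- the substitution q := N, the defining property of a q-Zeta polynomial
-- identifies its values with the integer weighted multichain sums
-- Σ_{e₁ ≤ ⋯ ≤ e_m} N^{f(e₁)+⋯+f(e_m)}.  Grouping multichains by their first
-- element gives a recursion for these sums, under which a multichain of
-- P × Q is a pair of multichains of P and Q, and a nonempty multichain of
-- P ⊔ Q lies entirely in P or entirely in Q.
module Submission where

open import Defs hiding (_≤_)
open import Data.Nat as ℕ using (ℕ; zero; suc; _<_; _≤_; s≤s; z≤n)
import Data.Nat.Properties as ℕ
open import Data.Nat.Divisibility using (_∣_; divides; >⇒∤)
open import Data.Nat.ListAction using (sum)
open import Data.Integer using (ℤ; +_; _+_; _-_; _*_; _^_; ∣_∣)
open import Data.Integer.Properties
  using ( +-identityˡ; +-identityʳ; +-assoc; *-identityˡ; *-zeroˡ; *-zeroʳ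
        ; *-distribˡ-+; *-distribʳ-+; *-cancelˡ-≡; ^-distribˡ-+-*; pos-+; pos-*
        ; abs-*; ∣i∣≡0⇒i≡0; i-j≡0⇒i≡j; i≡j⇒i-j≡0 )
open import Data.Integer.Tactic.RingSolver using (solve-∀)
open import Data.List using (List; []; _∷_; _++_; map; concatMap; foldr)
open import Data.Bool using (Bool; true; false; if_then_else_; _∧_)
open import Data.Product using (_×_; _,_; proj₁; proj₂)
open import Data.Sum using (inj₁; inj₂; [_,_])
open import Function using (const)
open import Relation.Nullary using (yes; no; contradiction)
open import Relation.Nullary.Decidable using (⌊_⌋)
open import Relation.Binary.PropositionalEquality
  using (_≡_; refl; sym; trans; cong; cong₂; module ≡-Reasoning)

open ≡-Reasoning

∑ : {A : Set} → List A → (A → ℤ) → ℤ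
∑ []      f = + 0
∑ (a ∷ l) f = f a + ∑ l f

syntax ∑ l (λ x → e) = ∑[ x ∈ l ] e

∑-cong : {A : Set} (l : List A) {f f′ : A → ℤ} → (∀ a → f a ≡ f′ a) → ∑ l f ≡ ∑ l f′
∑-cong []      f≡f′ = refl
∑-cong (a ∷ l) f≡f′ = cong₂ _+_ (f≡f′ a) (∑-cong l f≡f′)

∑-++ : {A : Set} (l l′ : List A) (f : A → ℤ) → ∑ (l ++ l′) f ≡ ∑ l f + ∑ l′ f
∑-++ []      l′ f = sym (+-identityˡ _)
∑-++ (a ∷ l) l′ f = trans (cong (_+_ (f a)) (∑-++ l l′ f)) (sym (+-assoc (f a) _ _))

∑-map : {A B : Set} (l : List A) (g : A → B) (f : B → ℤ) → ∑ (map g l) f ≡ ∑ l (λ a → f (g a))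
∑-map []      g f = refl
∑-map (a ∷ l) g f = cong (_+_ (f (g a))) (∑-map l g f)

∑-concatMap : {A B : Set} (l : List A) (g : A → List B) (f : B → ℤ)
  → ∑ (concatMap g l) f ≡ ∑[ a ∈ l ] ∑ (g a) f
∑-concatMap []      g f = refl
∑-concatMap (a ∷ l) g f =
  trans (∑-++ (g a) (concatMap g l) f) (cong (_+_ (∑ (g a) f)) (∑-concatMap l g f))

∑-*ˡ : {A : Set} (l : List A) (c : ℤ) (f : A → ℤ) → ∑[ a ∈ l ] (c * f a) ≡ c * ∑ l f
∑-*ˡ []      c f = sym (*-zeroʳ c)
∑-*ˡ (a ∷ l) c f = trans (cong (_+_ (c * f a)) (∑-*ˡ l c f)) (sym (*-distribˡ-+ c (f a) _))

∑-*-∑ : {A B : Set} (l : List A) (l′ : List B) (f : A → ℤ) (f′ : B → ℤ)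
  → ∑ l f * ∑ l′ f′ ≡ ∑[ a ∈ l ] ∑[ b ∈ l′ ] (f a * f′ b)
∑-*-∑ []      l′ f f′ = *-zeroˡ (∑ l′ f′)
∑-*-∑ (a ∷ l) l′ f f′ = trans (*-distribʳ-+ (∑ l′ f′) (f a) (∑ l f))
  (cong₂ _+_ (sym (∑-*ˡ l′ (f a) f′)) (∑-*-∑ l l′ f f′))

∑-zero : {A : Set} (l : List A) → ∑[ a ∈ l ] (+ 0) ≡ + 0
∑-zero []      = refl
∑-zero (a ∷ l) = trans (+-identityˡ _) (∑-zero l)

𝟙 : Bool → ℤ
𝟙 true  = + 1
𝟙 false = + 0

𝟙-∧ : ∀ b c → 𝟙 (b ∧ c) ≡ 𝟙 b * 𝟙 c
𝟙-∧ true  c = sym (*-identityˡ (𝟙 c))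
𝟙-∧ false c = refl

eval : Poly → ℤ → ℤ
eval []      t = + 0
eval (a ∷ p) t = a + t * eval p t

tailP : Poly → Poly
tailP []      = []
tailP (_ ∷ p) = p

eval-tailP : ∀ p t → eval p t ≡ coeff p 0 + t * eval (tailP p) t
eval-tailP []      t = cong (_+_ (+ 0)) (sym (*-zeroʳ t))
eval-tailP (a ∷ p) t = refl

coeff-tailP : ∀ p i → coeff p (suc i) ≡ coeff (tailP p) i
coeff-tailP []      i = refl
coeff-tailP (a ∷ p) i = refl

eval-cong : ∀ p r → p ≈P r → ∀ t → eval p t ≡ eval r t
eval-cong []      []      p≈r t = refl
eval-cong []      (b ∷ r) p≈r t = trans (eval-tailP [] t)
  (cong₂ (λ a e → a + t * e) (p≈r 0) (eval-cong [] r (λ i → p≈r (suc i)) t))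
eval-cong (a ∷ p) []      p≈r t = trans
  (cong₂ (λ a e → a + t * e) (p≈r 0) (eval-cong p [] (λ i → p≈r (suc i)) t)) (sym (eval-tailP [] t))
eval-cong (a ∷ p) (b ∷ r) p≈r t =
  cong₂ (λ a e → a + t * e) (p≈r 0) (eval-cong p r (λ i → p≈r (suc i)) t)

eval-+P : ∀ p r t → eval (p +P r) t ≡ eval p t + eval r t
eval-+P []      r       t = sym (+-identityˡ _)
eval-+P (a ∷ p) []      t = sym (+-identityʳ _)
eval-+P (a ∷ p) (b ∷ r) t = begin
  (a + b) + t * eval (p +P r) t          ≡⟨ cong (λ e → (a + b) + t * e) (eval-+P p r t) ⟩
  (a + b) + t * (eval p t + eval r t)    ≡⟨ interchange a b t (eval p t) (eval r t) ⟩
  (a + t * eval p t) + (b + t * eval r t) ∎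
  where
  interchange : ∀ a b t u v → (a + b) + t * (u + v) ≡ (a + t * u) + (b + t * v)
  interchange = solve-∀

eval-scale : ∀ a r t → eval (map (a *_) r) t ≡ a * eval r t
eval-scale a []      t = sym (*-zeroʳ a)
eval-scale a (b ∷ r) t = begin
  a * b + t * eval (map (a *_) r) t ≡⟨ cong (λ e → a * b + t * e) (eval-scale a r t) ⟩
  a * b + t * (a * eval r t)        ≡⟨ factor a b t (eval r t) ⟩
  a * (b + t * eval r t)            ∎
  where
  factor : ∀ a b t u → a * b + t * (a * u) ≡ a * (b + t * u)
  factor = solve-∀

eval-*P : ∀ p r t → eval (p *P r) t ≡ eval p t * eval r t
eval-*P []      r t = sym (*-zeroˡ (eval r t))
eval-*P (a ∷ p) r t = begin
  eval (map (a *_) r +P (+ 0 ∷ (p *P r))) t      ≡⟨ eval-+P (map (a *_) r) (+ 0 ∷ (p *P r)) t ⟩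
  eval (map (a *_) r) t + (+ 0 + t * eval (p *P r) t)
    ≡⟨ cong₂ (λ u v → u + (+ 0 + t * v)) (eval-scale a r t) (eval-*P p r t) ⟩
  a * eval r t + (+ 0 + t * (eval p t * eval r t)) ≡⟨ factor a t (eval p t) (eval r t) ⟩
  (a + t * eval p t) * eval r t                   ∎
  where
  factor : ∀ a t u v → a * v + (+ 0 + t * (u * v)) ≡ (a + t * u) * v
  factor = solve-∀

eval-mono : ∀ k t → eval (mono k) t ≡ t ^ k
eval-mono zero    t = cong (_+_ (+ 1)) (*-zeroʳ t)
eval-mono (suc k) t = trans (+-identityˡ _) (cong (t *_) (eval-mono k t))

eval-if-mono : ∀ b k t → eval (if b then mono k else []) t ≡ 𝟙 b * t ^ k
eval-if-mono true  k t = trans (eval-mono k t) (sym (*-identityˡ (t ^ k)))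
eval-if-mono false k t = refl

eval-foldr-+P : ∀ ps t → eval (foldr _+P_ [] ps) t ≡ ∑[ p ∈ ps ] eval p t
eval-foldr-+P []       t = refl
eval-foldr-+P (p ∷ ps) t = trans (eval-+P p _ t) (cong (_+_ (eval p t)) (eval-foldr-+P ps t))

repunit : ℕ → ℕ → ℕ
repunit N zero    = 0
repunit N (suc n) = 1 ℕ.+ N ℕ.* repunit N n

eval-qint : ∀ N n → eval (qint n) (+ N) ≡ + repunit N n
eval-qint N zero    = refl
eval-qint N (suc n) = begin
  + 1 + + N * eval (qint n) (+ N) ≡⟨ cong (λ e → + 1 + + N * e) (eval-qint N n) ⟩
  + 1 + + N * + repunit N n       ≡⟨ cong (_+_ (+ 1)) (pos-* N (repunit N n)) ⟨
  + 1 + + (N ℕ.* repunit N n)     ≡⟨ pos-+ 1 (N ℕ.* repunit N n) ⟨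
  + repunit N (suc n)             ∎

n≤repunit : ∀ N n → .{{ℕ.NonZero N}} → n ≤ repunit N n
n≤repunit N zero    = z≤n
n≤repunit N (suc n) = s≤s (ℕ.≤-trans (n≤repunit N n) (ℕ.m≤n*m (repunit N n) N))

-- A polynomial over ℤ is determined by its values on an unbounded set

difference-of-Horner : ∀ a b c d x → a + x * c ≡ b + x * d → a - b ≡ x * (d - c)
difference-of-Horner a b c d x eq = begin
  a - b                   ≡⟨ unshift a b x c ⟩
  (a + x * c) - b - x * c ≡⟨ cong (λ e → e - b - x * c) eq ⟩
  (b + x * d) - b - x * c ≡⟨ collect b x c d ⟩
  x * (d - c)             ∎
  where
  unshift : ∀ a b x c → a - b ≡ (a + x * c) - b - x * c
  unshift = solve-∀
  collect : ∀ b x c d → (b + x * d) - b - x * c ≡ x * (d - c)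
  collect = solve-∀

n∣m<n⇒m≡0 : ∀ {m n} → n ∣ m → m < n → m ≡ 0
n∣m<n⇒m≡0 {zero}  n∣m m<n = refl
n∣m<n⇒m≡0 {suc m} n∣m m<n = contradiction n∣m (>⇒∤ m<n)

Horner-head-≡ : ∀ {a b c d X} → ∣ a - b ∣ < X → a + + X * c ≡ b + + X * d → a ≡ b
Horner-head-≡ {a} {b} {c} {d} {X} small eq =
  i-j≡0⇒i≡j a b (∣i∣≡0⇒i≡0 (n∣m<n⇒m≡0 X∣a-b small))
  where
  X∣a-b : X ∣ ∣ a - b ∣
  X∣a-b = divides ∣ d - c ∣ (begin
    ∣ a - b ∣              ≡⟨ cong ∣_∣ (difference-of-Horner a b c d (+ X) eq) ⟩
    ∣ + X * (d - c) ∣      ≡⟨ abs-* (+ X) (d - c) ⟩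
    X ℕ.* ∣ d - c ∣        ≡⟨ ℕ.*-comm X ∣ d - c ∣ ⟩
    ∣ d - c ∣ ℕ.* X        ∎)

Horner-tail-≡ : ∀ {a b c d X} → .{{ℕ.NonZero X}} → a ≡ b → a + + X * c ≡ b + + X * d → c ≡ d
Horner-tail-≡ {a} {b} {c} {d} {X} refl eq =
  sym (i-j≡0⇒i≡j d c (*-cancelˡ-≡ (+ X) (d - c) (+ 0) X*[d-c]≡X*0))
  where
  X*[d-c]≡X*0 : + X * (d - c) ≡ + X * + 0
  X*[d-c]≡X*0 = begin
    + X * (d - c) ≡⟨ difference-of-Horner a a c d (+ X) eq ⟨
    a - a         ≡⟨ i≡j⇒i-j≡0 {a} refl ⟩
    + 0           ≡⟨ *-zeroʳ (+ X) ⟨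
    + X * + 0     ∎

module HeadAndTail (x : ℕ → ℕ) (n<x : ∀ n → n < x n) (p r : Poly)
  (agree : ∀ n → eval p (+ x n) ≡ eval r (+ x n)) where

  agree-split : ∀ n → coeff p 0 + + x n * eval (tailP p) (+ x n)
                     ≡ coeff r 0 + + x n * eval (tailP r) (+ x n)
  agree-split n = trans (sym (eval-tailP p _)) (trans (agree n) (eval-tailP r _))

  heads-≡ : coeff p 0 ≡ coeff r 0
  heads-≡ = Horner-head-≡ (n<x gap) (agree-split gap)
    where gap = ∣ coeff p 0 - coeff r 0 ∣

  tails-agree : ∀ n → eval (tailP p) (+ x n) ≡ eval (tailP r) (+ x n)
  tails-agree n =
    Horner-tail-≡ {{ℕ.>-nonZero (ℕ.≤-<-trans z≤n (n<x n))}} heads-≡ (agree-split n)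

≈P-from-values : (x : ℕ → ℕ) → (∀ n → n < x n) → ∀ p r
  → (∀ n → eval p (+ x n) ≡ eval r (+ x n)) → p ≈P r
≈P-from-values x n<x p r agree zero    = heads-≡
  where open HeadAndTail x n<x p r agree
≈P-from-values x n<x p r agree (suc i) = begin
  coeff p (suc i)   ≡⟨ coeff-tailP p i ⟩
  coeff (tailP p) i ≡⟨ ≈P-from-values x n<x (tailP p) (tailP r) tails-agree i ⟩
  coeff (tailP r) i ≡⟨ coeff-tailP r i ⟨
  coeff r (suc i)   ∎
  where open HeadAndTail x n<x p r agree

specialise : ℤ → PolyX → Poly
specialise N = map (λ c → eval c N)

eval₂ : PolyX → ℤ → ℤ → ℤ
eval₂ D N t = eval (specialise N D) t

coeff-specialise : ∀ N D i → coeff (specialise N D) i ≡ eval (coeffX D i) N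
coeff-specialise N []      i       = refl
coeff-specialise N (c ∷ D) zero    = refl
coeff-specialise N (c ∷ D) (suc i) = coeff-specialise N D i

eval-evalX : ∀ D t N → eval (evalX D t) N ≡ eval₂ D N (eval t N)
eval-evalX []      t N = refl
eval-evalX (c ∷ D) t N = begin
  eval (c +P (t *P evalX D t)) N               ≡⟨ eval-+P c _ N ⟩
  eval c N + eval (t *P evalX D t) N           ≡⟨ cong (_+_ (eval c N)) (eval-*P t (evalX D t) N) ⟩
  eval c N + eval t N * eval (evalX D t) N
    ≡⟨ cong (λ e → eval c N + eval t N * e) (eval-evalX D t N) ⟩
  eval c N + eval t N * eval₂ D N (eval t N)   ∎

specialise-+X : ∀ N D E → specialise N (D +X E) ≡ specialise N D +P specialise N E
specialise-+X N []      E       = refl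
specialise-+X N (a ∷ D) []      = refl
specialise-+X N (a ∷ D) (b ∷ E) = cong₂ _∷_ (eval-+P a b N) (specialise-+X N D E)

specialise-·X : ∀ N d D → specialise N (d ·X D) ≡ map (eval d N *_) (specialise N D)
specialise-·X N d []      = refl
specialise-·X N d (c ∷ D) = cong₂ _∷_ (eval-*P d c N) (specialise-·X N d D)

specialise-*X : ∀ N D E → specialise N (D *X E) ≡ specialise N D *P specialise N E
specialise-*X N []      E = refl
specialise-*X N (a ∷ D) E = begin
  specialise N ((a ·X E) +X ([] ∷ (D *X E)))
    ≡⟨ specialise-+X N (a ·X E) ([] ∷ (D *X E)) ⟩
  specialise N (a ·X E) +P (+ 0 ∷ specialise N (D *X E))
    ≡⟨ cong₂ (λ u v → u +P (+ 0 ∷ v)) (specialise-·X N a E) (specialise-*X N D E) ⟩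
  map (eval a N *_) (specialise N E) +P (+ 0 ∷ (specialise N D *P specialise N E)) ∎

eval₂-+X : ∀ D E N t → eval₂ (D +X E) N t ≡ eval₂ D N t + eval₂ E N t
eval₂-+X D E N t =
  trans (cong (λ p → eval p t) (specialise-+X N D E)) (eval-+P (specialise N D) (specialise N E) t)

eval₂-·X : ∀ d D N t → eval₂ (d ·X D) N t ≡ eval d N * eval₂ D N t
eval₂-·X d D N t =
  trans (cong (λ p → eval p t) (specialise-·X N d D)) (eval-scale (eval d N) (specialise N D) t)

eval₂-*X : ∀ D E N t → eval₂ (D *X E) N t ≡ eval₂ D N t * eval₂ E N t
eval₂-*X D E N t =
  trans (cong (λ p → eval p t) (specialise-*X N D E)) (eval-*P (specialise N D) (specialise N E) t)

≈X-from-values : (y : ℕ → ℕ → ℕ) → (∀ k n → n < y k n) → ∀ A B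
  → (∀ k n → eval₂ A (+ suc k) (+ y k n) ≡ eval₂ B (+ suc k) (+ y k n)) → A ≈X B
≈X-from-values y n<y A B agree i =
  ≈P-from-values suc ℕ.n<1+n (coeffX A i) (coeffX B i) λ k → begin
    eval (coeffX A i) (+ suc k)       ≡⟨ coeff-specialise (+ suc k) A i ⟨
    coeff (specialise (+ suc k) A) i
      ≡⟨ ≈P-from-values (y k) (n<y k) (specialise (+ suc k) A) (specialise (+ suc k) B) (agree k) i ⟩
    coeff (specialise (+ suc k) B) i  ≡⟨ coeff-specialise (+ suc k) B i ⟩
    eval (coeffX B i) (+ suc k)       ∎

≈Z-from-values : ∀ Z W
  → (∀ k n → eval (den W) (+ suc k) * eval₂ (num Z) (+ suc k) (+ repunit (suc k) (2 ℕ.+ n))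
           ≡ eval (den Z) (+ suc k) * eval₂ (num W) (+ suc k) (+ repunit (suc k) (2 ℕ.+ n)))
  → Z ≈Z W
≈Z-from-values Z W agree =
  ≈X-from-values (λ k n → repunit (suc k) (2 ℕ.+ n)) n<repunit
    (den W ·X num Z) (den Z ·X num W) λ k n →
      trans (eval₂-·X (den W) (num Z) _ _) (trans (agree k n) (sym (eval₂-·X (den Z) (num W) _ _)))
  where
  n<repunit : ∀ k n → n < repunit (suc k) (2 ℕ.+ n)
  n<repunit k n = ℕ.<-≤-trans (ℕ.m<n+m n (s≤s z≤n)) (n≤repunit (suc k) (2 ℕ.+ n))

above : (R : FinOrd) → Carrier R → Carrier R → Bool
above R x y = ⌊ _≤?_ R x y ⌋

startsIn : {A : Set} → (A → Bool) → List A → Bool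
startsIn p []      = true
startsIn p (x ∷ _) = p x

module _ (N : ℤ) (R : FinOrd) (f : Carrier R → ℕ) where

  -- Σ over multichains e₁ ≤ ⋯ ≤ e_m with p e₁ of N^(f e₁ + ⋯ + f e_m)
  chainSum : (Carrier R → Bool) → ℕ → ℤ
  chainSum p zero    = + 1
  chainSum p (suc m) = ∑[ y ∈ elems R ] (𝟙 (p y) * (N ^ f y * chainSum (above R y) m))

  chainSum-cong : ∀ {p p′} → (∀ x → p x ≡ p′ x) → ∀ m → chainSum p m ≡ chainSum p′ m
  chainSum-cong p≡p′ zero    = refl
  chainSum-cong p≡p′ (suc m) = ∑-cong (elems R) λ y → cong (λ b → 𝟙 b * _) (p≡p′ y)

  weaklyIncreasing-∷ : ∀ y s
    → weaklyIncreasing R (y ∷ s) ≡ startsIn (above R y) s ∧ weaklyIncreasing R s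
  weaklyIncreasing-∷ y []      = refl
  weaklyIncreasing-∷ y (z ∷ s) = refl

  ∑-seqs-suc : ∀ m (φ : List (Carrier R) → ℤ)
    → ∑ (seqs R (suc m)) φ ≡ ∑[ y ∈ elems R ] ∑[ s ∈ seqs R m ] φ (y ∷ s)
  ∑-seqs-suc m φ = trans (∑-concatMap (elems R) (λ y → map (y ∷_) (seqs R m)) φ)
    (∑-cong (elems R) λ y → ∑-map (seqs R m) (y ∷_) φ)

  ∑-multichains : ∀ p m
    → ∑[ s ∈ seqs R m ] (𝟙 (startsIn p s ∧ weaklyIncreasing R s) * N ^ sum (map f s))
      ≡ chainSum p m
  ∑-multichains p zero    = refl
  ∑-multichains p (suc m) = begin
    ∑[ s ∈ seqs R (suc m) ] (𝟙 (startsIn p s ∧ weaklyIncreasing R s) * N ^ sum (map f s))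
      ≡⟨ ∑-seqs-suc m _ ⟩
    ∑[ y ∈ elems R ] ∑[ s ∈ seqs R m ]
      (𝟙 (p y ∧ weaklyIncreasing R (y ∷ s)) * N ^ (f y ℕ.+ sum (map f s)))
      ≡⟨ ∑-cong (elems R) (λ y → ∑-cong (seqs R m) (split-first y)) ⟩
    ∑[ y ∈ elems R ] ∑[ s ∈ seqs R m ] (𝟙 (p y) * (N ^ f y * rest y s))
      ≡⟨ ∑-cong (elems R) factor-out ⟩
    chainSum p (suc m) ∎
    where
    rest : Carrier R → List (Carrier R) → ℤ
    rest y s = 𝟙 (startsIn (above R y) s ∧ weaklyIncreasing R s) * N ^ sum (map f s)
    rearrange : ∀ a b u v → (a * b) * (u * v) ≡ a * (u * (b * v))
    rearrange = solve-∀
    split-first : ∀ y s → 𝟙 (p y ∧ weaklyIncreasing R (y ∷ s)) * N ^ (f y ℕ.+ sum (map f s))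
                         ≡ 𝟙 (p y) * (N ^ f y * rest y s)
    split-first y s = begin
      𝟙 (p y ∧ weaklyIncreasing R (y ∷ s)) * N ^ (f y ℕ.+ sum (map f s))
        ≡⟨ cong₂ _*_ (trans (cong (λ b → 𝟙 (p y ∧ b)) (weaklyIncreasing-∷ y s)) (𝟙-∧ (p y) _))
                     (^-distribˡ-+-* N (f y) (sum (map f s))) ⟩
      (𝟙 (p y) * 𝟙 (startsIn (above R y) s ∧ weaklyIncreasing R s)) * (N ^ f y * N ^ sum (map f s))
        ≡⟨ rearrange (𝟙 (p y)) _ (N ^ f y) _ ⟩
      𝟙 (p y) * (N ^ f y * rest y s) ∎
    factor-out : ∀ y → ∑[ s ∈ seqs R m ] (𝟙 (p y) * (N ^ f y * rest y s))
                       ≡ 𝟙 (p y) * (N ^ f y * chainSum (above R y) m)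
    factor-out y = begin
      ∑[ s ∈ seqs R m ] (𝟙 (p y) * (N ^ f y * rest y s))
        ≡⟨ ∑-*ˡ (seqs R m) (𝟙 (p y)) (λ s → N ^ f y * rest y s) ⟩
      𝟙 (p y) * ∑[ s ∈ seqs R m ] (N ^ f y * rest y s)
        ≡⟨ cong (𝟙 (p y) *_) (∑-*ˡ (seqs R m) (N ^ f y) (rest y)) ⟩
      𝟙 (p y) * (N ^ f y * ∑ (seqs R m) (rest y))
        ≡⟨ cong (λ c → 𝟙 (p y) * (N ^ f y * c)) (∑-multichains (above R y) m) ⟩
      𝟙 (p y) * (N ^ f y * chainSum (above R y) m) ∎

  eval-multichainPoly : ∀ m → eval (multichainPoly R f m) N ≡ chainSum (const true) m
  eval-multichainPoly m = begin
    eval (multichainPoly R f m) N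
      ≡⟨ eval-foldr-+P (map term (seqs R m)) N ⟩
    ∑[ t ∈ map term (seqs R m) ] eval t N
      ≡⟨ ∑-map (seqs R m) term (λ t → eval t N) ⟩
    ∑[ s ∈ seqs R m ] eval (term s) N
      ≡⟨ ∑-cong (seqs R m) eval-term ⟩
    ∑[ s ∈ seqs R m ] (𝟙 (startsIn (const true) s ∧ weaklyIncreasing R s) * N ^ sum (map f s))
      ≡⟨ ∑-multichains (const true) m ⟩
    chainSum (const true) m ∎
    where
    term : List (Carrier R) → Poly
    term s = if weaklyIncreasing R s then mono (sum (map f s)) else []
    eval-term : ∀ s → eval (term s) N
                    ≡ 𝟙 (startsIn (const true) s ∧ weaklyIncreasing R s) * N ^ sum (map f s)
    eval-term []      = eval-if-mono (weaklyIncreasing R []) 0 N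
    eval-term (x ∷ s) = eval-if-mono (weaklyIncreasing R (x ∷ s)) (sum (map f (x ∷ s))) N

  chainSum-false : ∀ m → chainSum (const false) (suc m) ≡ + 0
  chainSum-false m = trans (∑-cong (elems R) (λ y → *-zeroˡ (N ^ f y * chainSum (above R y) m)))
                           (∑-zero (elems R))

module _ (N : ℤ) (P Q : FinOrd) (g : Carrier P → ℕ) (h : Carrier Q → ℕ) where

  above-× : ∀ a b u → above (P ×ₚ Q) (a , b) u ≡ above P a (proj₁ u) ∧ above Q b (proj₂ u)
  above-× a b (a′ , b′) with _≤?_ P a a′ | _≤?_ Q b b′
  ... | yes _ | yes _ = refl
  ... | yes _ | no _  = refl
  ... | no _  | _     = refl

  chainSum-× : ∀ p q m
    → chainSum N (P ×ₚ Q) (heightSum P Q g h) (λ u → p (proj₁ u) ∧ q (proj₂ u)) m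
      ≡ chainSum N P g p m * chainSum N Q h q m
  chainSum-× p q zero    = refl
  chainSum-× p q (suc m) = begin
    ∑ (concatMap (λ a → map (a ,_) (elems Q)) (elems P)) term
      ≡⟨ ∑-concatMap (elems P) (λ a → map (a ,_) (elems Q)) term ⟩
    ∑[ a ∈ elems P ] ∑ (map (a ,_) (elems Q)) term
      ≡⟨ ∑-cong (elems P) (λ a →
           trans (∑-map (elems Q) (a ,_) term) (∑-cong (elems Q) (term-split a))) ⟩
    ∑[ a ∈ elems P ] ∑[ b ∈ elems Q ] (termP a * termQ b)
      ≡⟨ ∑-*-∑ (elems P) (elems Q) termP termQ ⟨
    chainSum N P g p (suc m) * chainSum N Q h q (suc m) ∎
    where
    term : Carrier (P ×ₚ Q) → ℤ
    term u = 𝟙 (p (proj₁ u) ∧ q (proj₂ u))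
           * (N ^ heightSum P Q g h u * chainSum N (P ×ₚ Q) (heightSum P Q g h) (above (P ×ₚ Q) u) m)
    termP : Carrier P → ℤ
    termP a = 𝟙 (p a) * (N ^ g a * chainSum N P g (above P a) m)
    termQ : Carrier Q → ℤ
    termQ b = 𝟙 (q b) * (N ^ h b * chainSum N Q h (above Q b) m)
    rearrange : ∀ a b u v c d → (a * b) * ((u * v) * (c * d)) ≡ (a * (u * c)) * (b * (v * d))
    rearrange = solve-∀
    term-split : ∀ a b → term (a , b) ≡ termP a * termQ b
    term-split a b = begin
      term (a , b)
        ≡⟨ cong₂ _*_ (𝟙-∧ (p a) (q b)) (cong₂ _*_ (^-distribˡ-+-* N (g a) (h b))
             (trans (chainSum-cong N (P ×ₚ Q) (heightSum P Q g h) (above-× a b) m)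
                    (chainSum-× (above P a) (above Q b) m))) ⟩
      (𝟙 (p a) * 𝟙 (q b)) * ((N ^ g a * N ^ h b)
        * (chainSum N P g (above P a) m * chainSum N Q h (above Q b) m))
        ≡⟨ rearrange (𝟙 (p a)) (𝟙 (q b)) (N ^ g a) (N ^ h b) _ _ ⟩
      termP a * termQ b ∎

  above-inj₁ : ∀ a u → above (P ⊎ₚ Q) (inj₁ a) u ≡ [ above P a , const false ] u
  above-inj₁ a (inj₁ a′) with _≤?_ P a a′
  ... | yes _ = refl
  ... | no _  = refl
  above-inj₁ a (inj₂ b′) = refl

  above-inj₂ : ∀ b u → above (P ⊎ₚ Q) (inj₂ b) u ≡ [ const false , above Q b ] u
  above-inj₂ b (inj₁ a′) = refl
  above-inj₂ b (inj₂ b′) with _≤?_ Q b b′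
  ... | yes _ = refl
  ... | no _  = refl

  chainSum⊎ : (Carrier (P ⊎ₚ Q) → Bool) → ℕ → ℤ
  chainSum⊎ = chainSum N (P ⊎ₚ Q) (heightUnion P Q g h)

  -- Only for nonempty multichains: the empty one would be counted once for P and once for Q.
  chainSum-⊎ : ∀ p q m
    → chainSum⊎ [ p , q ] (suc m) ≡ chainSum N P g p (suc m) + chainSum N Q h q (suc m)
  chainSum-inj₁ : ∀ p m → chainSum⊎ [ p , const false ] m ≡ chainSum N P g p m
  chainSum-inj₂ : ∀ q m → chainSum⊎ [ const false , q ] m ≡ chainSum N Q h q m

  chainSum-⊎ p q m = begin
    ∑ (map inj₁ (elems P) ++ map inj₂ (elems Q)) term
      ≡⟨ ∑-++ (map inj₁ (elems P)) (map inj₂ (elems Q)) term ⟩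
    ∑ (map inj₁ (elems P)) term + ∑ (map inj₂ (elems Q)) term
      ≡⟨ cong₂ _+_ (trans (∑-map (elems P) inj₁ term) (∑-cong (elems P) term-inj₁))
                   (trans (∑-map (elems Q) inj₂ term) (∑-cong (elems Q) term-inj₂)) ⟩
    chainSum N P g p (suc m) + chainSum N Q h q (suc m) ∎
    where
    term : Carrier (P ⊎ₚ Q) → ℤ
    term u = 𝟙 ([ p , q ] u) * (N ^ heightUnion P Q g h u * chainSum⊎ (above (P ⊎ₚ Q) u) m)
    term-inj₁ : ∀ a → term (inj₁ a) ≡ 𝟙 (p a) * (N ^ g a * chainSum N P g (above P a) m)
    term-inj₁ a = cong (λ c → 𝟙 (p a) * (N ^ g a * c))
      (trans (chainSum-cong N (P ⊎ₚ Q) (heightUnion P Q g h) (above-inj₁ a) m)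
             (chainSum-inj₁ (above P a) m))
    term-inj₂ : ∀ b → term (inj₂ b) ≡ 𝟙 (q b) * (N ^ h b * chainSum N Q h (above Q b) m)
    term-inj₂ b = cong (λ c → 𝟙 (q b) * (N ^ h b * c))
      (trans (chainSum-cong N (P ⊎ₚ Q) (heightUnion P Q g h) (above-inj₂ b) m)
             (chainSum-inj₂ (above Q b) m))

  chainSum-inj₁ p zero    = refl
  chainSum-inj₁ p (suc m) = begin
    chainSum⊎ [ p , const false ] (suc m)
      ≡⟨ chainSum-⊎ p (const false) m ⟩
    chainSum N P g p (suc m) + chainSum N Q h (const false) (suc m)
      ≡⟨ cong (_+_ (chainSum N P g p (suc m))) (chainSum-false N Q h m) ⟩
    chainSum N P g p (suc m) + + 0
      ≡⟨ +-identityʳ _ ⟩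
    chainSum N P g p (suc m) ∎

  chainSum-inj₂ q zero    = refl
  chainSum-inj₂ q (suc m) = begin
    chainSum⊎ [ const false , q ] (suc m)
      ≡⟨ chainSum-⊎ (const false) q m ⟩
    chainSum N P g (const false) (suc m) + chainSum N Q h q (suc m)
      ≡⟨ cong (_+ _) (chainSum-false N P g m) ⟩
    + 0 + chainSum N Q h q (suc m)
      ≡⟨ +-identityˡ _ ⟩
    chainSum N Q h q (suc m) ∎

IsQZeta-values : ∀ R f Z → IsQZeta R f Z → ∀ k n
  → eval₂ (num Z) (+ suc k) (+ repunit (suc k) (2 ℕ.+ n))
    ≡ eval (den Z) (+ suc k) * chainSum (+ suc k) R f (const true) (suc n)
IsQZeta-values R f Z (_ , values) k n = begin
  eval₂ (num Z) N (+ repunit (suc k) (2 ℕ.+ n))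
    ≡⟨ cong (eval₂ (num Z) N) (eval-qint (suc k) (2 ℕ.+ n)) ⟨
  eval₂ (num Z) N (eval (qint (2 ℕ.+ n)) N)
    ≡⟨ eval-evalX (num Z) (qint (2 ℕ.+ n)) N ⟨
  eval (evalX (num Z) (qint (2 ℕ.+ n))) N
    ≡⟨ eval-cong (evalX (num Z) (qint (2 ℕ.+ n))) (den Z *P multichainPoly R f (suc n))
                 (values n) N ⟩
  eval (den Z *P multichainPoly R f (suc n)) N
    ≡⟨ eval-*P (den Z) (multichainPoly R f (suc n)) N ⟩
  eval (den Z) N * eval (multichainPoly R f (suc n)) N
    ≡⟨ cong (eval (den Z) N *_) (eval-multichainPoly N R f (suc n)) ⟩
  eval (den Z) N * chainSum N R f (const true) (suc n) ∎
  where
  N : ℤ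
  N = + suc k

IsQZeta-× : ∀ P Q g h ZP ZQ Z× → IsQZeta P g ZP → IsQZeta Q h ZQ
  → IsQZeta (P ×ₚ Q) (heightSum P Q g h) Z× → Z× ≈Z (ZP ·Z ZQ)
IsQZeta-× P Q g h ZP ZQ Z× isP isQ is× = ≈Z-from-values Z× (ZP ·Z ZQ) λ k n →
  let N = + suc k ; x = + repunit (suc k) (2 ℕ.+ n)
      dP = eval (den ZP) N ; dQ = eval (den ZQ) N ; d× = eval (den Z×) N
      cP = chainSum N P g (const true) (suc n) ; cQ = chainSum N Q h (const true) (suc n)
  in begin
    eval (den ZP *P den ZQ) N * eval₂ (num Z×) N x
      ≡⟨ cong₂ _*_ (eval-*P (den ZP) (den ZQ) N)
                   (IsQZeta-values (P ×ₚ Q) (heightSum P Q g h) Z× is× k n) ⟩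
    (dP * dQ) * (d× * chainSum N (P ×ₚ Q) (heightSum P Q g h) (const true) (suc n))
      ≡⟨ cong (λ c → (dP * dQ) * (d× * c)) (chainSum-× N P Q g h (const true) (const true) (suc n)) ⟩
    (dP * dQ) * (d× * (cP * cQ))
      ≡⟨ rearrange dP dQ d× cP cQ ⟩
    d× * ((dP * cP) * (dQ * cQ))
      ≡⟨ cong (d× *_) (cong₂ _*_ (IsQZeta-values P g ZP isP k n) (IsQZeta-values Q h ZQ isQ k n)) ⟨
    d× * (eval₂ (num ZP) N x * eval₂ (num ZQ) N x)
      ≡⟨ cong (d× *_) (eval₂-*X (num ZP) (num ZQ) N x) ⟨
    d× * eval₂ (num ZP *X num ZQ) N x ∎
  where
  rearrange : ∀ a b c u v → (a * b) * (c * (u * v)) ≡ c * ((a * u) * (b * v))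
  rearrange = solve-∀

IsQZeta-⊎ : ∀ P Q g h ZP ZQ Z⊎ → IsQZeta P g ZP → IsQZeta Q h ZQ
  → IsQZeta (P ⊎ₚ Q) (heightUnion P Q g h) Z⊎ → Z⊎ ≈Z (ZP +Z ZQ)
IsQZeta-⊎ P Q g h ZP ZQ Z⊎ isP isQ is⊎ = ≈Z-from-values Z⊎ (ZP +Z ZQ) λ k n →
  let N = + suc k ; x = + repunit (suc k) (2 ℕ.+ n)
      dP = eval (den ZP) N ; dQ = eval (den ZQ) N ; d⊎ = eval (den Z⊎) N
      cP = chainSum N P g (const true) (suc n) ; cQ = chainSum N Q h (const true) (suc n)
  in begin
    eval (den ZP *P den ZQ) N * eval₂ (num Z⊎) N x
      ≡⟨ cong₂ _*_ (eval-*P (den ZP) (den ZQ) N)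
                   (IsQZeta-values (P ⊎ₚ Q) (heightUnion P Q g h) Z⊎ is⊎ k n) ⟩
    (dP * dQ) * (d⊎ * chainSum N (P ⊎ₚ Q) (heightUnion P Q g h) (const true) (suc n))
      ≡⟨ cong (λ c → (dP * dQ) * (d⊎ * c))
           (trans (chainSum-cong N (P ⊎ₚ Q) (heightUnion P Q g h) both-true (suc n))
                  (chainSum-⊎ N P Q g h (const true) (const true) n)) ⟩
    (dP * dQ) * (d⊎ * (cP + cQ))
      ≡⟨ rearrange dP dQ d⊎ cP cQ ⟩
    d⊎ * (dQ * (dP * cP) + dP * (dQ * cQ))
      ≡⟨ cong (λ e → d⊎ * e) (cong₂ (λ u v → dQ * u + dP * v)
           (IsQZeta-values P g ZP isP k n) (IsQZeta-values Q h ZQ isQ k n)) ⟨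
    d⊎ * (dQ * eval₂ (num ZP) N x + dP * eval₂ (num ZQ) N x)
      ≡⟨ cong (d⊎ *_) (cong₂ _+_ (eval₂-·X (den ZQ) (num ZP) N x)
                                 (eval₂-·X (den ZP) (num ZQ) N x)) ⟨
    d⊎ * (eval₂ (den ZQ ·X num ZP) N x + eval₂ (den ZP ·X num ZQ) N x)
      ≡⟨ cong (d⊎ *_) (eval₂-+X (den ZQ ·X num ZP) (den ZP ·X num ZQ) N x) ⟨
    d⊎ * eval₂ ((den ZQ ·X num ZP) +X (den ZP ·X num ZQ)) N x ∎
  where
  rearrange : ∀ a b c u v → (a * b) * (c * (u + v)) ≡ c * (b * (a * u) + a * (b * v))
  rearrange = solve-∀
  both-true : ∀ u → const true u ≡ [ const true , const true ] u
  both-true (inj₁ _) = refl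
  both-true (inj₂ _) = refl

mainTheorem9 : (P Q : FinOrd) → IsFinPoset P → IsFinPoset Q
    → (g : Carrier P → ℕ) → (h : Carrier Q → ℕ) → IsHeight P g → IsHeight Q h
    → (ZP ZQ ZP×Q ZP⊎Q : QX)
    → IsQZeta P g ZP → IsQZeta Q h ZQ
    → IsQZeta (P ×ₚ Q) (heightSum P Q g h) ZP×Q
    → IsQZeta (P ⊎ₚ Q) (heightUnion P Q g h) ZP⊎Q
    → (ZP×Q ≈Z (ZP ·Z ZQ)) × (ZP⊎Q ≈Z (ZP +Z ZQ))
mainTheorem9 P Q _ _ g h _ _ ZP ZQ ZP×Q ZP⊎Q isP isQ is× is⊎ =
    IsQZeta-× P Q g h ZP ZQ ZP×Q isP isQ is×
  , IsQZeta-⊎ P Q g h ZP ZQ ZP⊎Q isP isQ is⊎
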